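{- Let $G$ be a graph and $k\ge 2$ a positive integer, with access to a BISE oracle for $G$. For an integer $b$, the sampling primitive $\mathcal{S}_b$ is: choose a random hash function $h:V(G)\to[b]$ (each vertex colored uniformly and independently at random), let $V_i=\{v:h(v)=i\}$, make a BISE query on $(V_i,V_j)$ for every pair $i\ne j$ with $V_i,V_j\ne\emptyset$, and let $G^h$ be the subgraph of $G$ on vertex set $V(G)$ whose edges are the edges returned. Let $\hat G=G_1\cup\dots\cup G_{100\log k}$ where $G_1,\dots,G_{100\log k}$ are independent samples of $\mathcal{S}_{1000k}$. Let $V_h$ be the set of vertices of $G$ of degree at least $20k$, $V_\ell=V(G)\setminus V_h$, and $E_\ell$ the set of edges of $G$ with both endpoints in $V_\ell$. If $G$ has a vertex cover of size at most $k$, then with probability at least $1-1/k^{c}$ for some constant $c>0$ both of the following hold: (i) $E_\ell\subseteq E(\hat G)$, and (ii) every $u\in V_h$ has degree at least $2k$ in $\hat G$.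
   Context: The BISE oracle takes two disjoint non-empty vertex subsets $A,B$ and returns some edge of $G$ with one endpoint in $A$ and one in $B$ (an arbitrary such edge) if one exists, and NULL otherwise; the probability holds whatever valid answers the oracle gives. -}

module Defs where

open import Data.Nat using (ℕ; _+_; _*_; _∸_; _^_; _≤_; _<_)
open import Data.Nat.Logarithm using (⌈log₂_⌉)
open import Data.Bool using (Bool; true)
open import Data.Fin using (Fin)
open import Data.Fin.Subset using (Subset; ∣_∣; _∈_)
open import Data.Vec using (Vec; lookup; tabulate)
open import Data.List using (List; length)
open import Data.List.Relation.Unary.All using (All)
open import Data.List.Relation.Unary.Unique.Propositional using (Unique)
open import Data.Maybe using (Maybe; just; nothing)
open import Data.Product using (Σ; ∃; ∃-syntax; _×_; _,_)
open import Data.Sum using (_⊎_)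
open import Relation.Nullary using (¬_)
open import Relation.Binary.PropositionalEquality using (_≡_; _≢_)

record Graph (n : ℕ) : Set where
  field
    adj    : Fin n → Fin n → Bool
    sym    : ∀ u v → adj u v ≡ adj v u
    irrefl : ∀ u → ¬ (adj u u ≡ true)
open Graph public

Edge : ∀ {n} → Graph n → Fin n → Fin n → Set
Edge G u v = adj G u v ≡ true

degree : ∀ {n} → Graph n → Fin n → ℕ
degree G u = ∣ tabulate (adj G u) ∣

HasVertexCoverOfSize≤ : ∀ {n} → Graph n → ℕ → Set
HasVertexCoverOfSize≤ {n} G k =
  Σ (Subset n) λ C → ∣ C ∣ ≤ k × (∀ u v → Edge G u v → u ∈ C ⊎ v ∈ C)

Hash : ℕ → ℕ → Set
Hash n b = Vec (Fin b) n

-- Answers to BISE queries on the colour-class pairs (V_i , V_j).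
Answers : ℕ → ℕ → Set
Answers n b = Fin b → Fin b → Maybe (Fin n × Fin n)

-- Validity of the oracle's answers to the queries (V_i , V_j), i ≠ j.
-- (If V_i or V_j is empty there is no edge between them, so the
--  answer is forced to be NULL; such pairs contribute no edge, exactly
--  as unqueried pairs.)  The answers are otherwise arbitrary.
ValidAnswers : ∀ {n b} → Graph n → Hash n b → Answers n b → Set
ValidAnswers {n} {b} G h ans =
  ∀ (i j : Fin b) → i ≢ j →
    (ans i j ≡ nothing →
       ∀ u v → lookup h u ≡ i → lookup h v ≡ j → ¬ Edge G u v)
    × (∀ u v → ans i j ≡ just (u , v) →
         lookup h u ≡ i × lookup h v ≡ j × Edge G u v)

HatEdge : ∀ {n b t} → (Fin t → Answers n b) → Fin n → Fin n → Set
HatEdge {n} {b} {t} ans u v =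
  ∃[ s ] ∃[ i ] ∃[ j ] (i ≢ j × (ans s i j ≡ just (u , v) ⊎ ans s i j ≡ just (v , u)))

HatDegree≥ : ∀ {n b t} → (Fin t → Answers n b) → Fin n → ℕ → Set
HatDegree≥ {n} ans u d =
  Σ (List (Fin n)) λ L → Unique L × All (HatEdge ans u) L × d ≤ length L

numColours : ℕ → ℕ
numColours k = 1000 * k

numSamples : ℕ → ℕ
numSamples k = 100 * ⌈log₂ k ⌉

Outcome : ℕ → ℕ → Set
Outcome n k = Vec (Hash n (numColours k)) (numSamples k)

-- Good outcome: for EVERY valid behaviour of the oracle, (i) and (ii) hold.
Good : ∀ {n} → Graph n → (k : ℕ) → Outcome n k → Set
Good {n} G k ω =
  ∀ (ans : Fin (numSamples k) → Answers n (numColours k)) →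
    (∀ s → ValidAnswers G (lookup ω s) (ans s)) →
      (∀ u v → Edge G u v → degree G u < 20 * k → degree G v < 20 * k →
         HatEdge ans u v)
      × (∀ u → 20 * k ≤ degree G u → HatDegree≥ ans u (2 * k))

numOutcomes : ℕ → ℕ → ℕ
numOutcomes n k = (numColours k ^ n) ^ numSamples k

-- Pr[Good] ≥ 1 - 1/k^(p/q), i.e. at least g distinct good outcomes with
-- (T - g)^q · k^p ≤ T^q  where T is the number of outcomes.
ProbGoodAtLeast : ∀ {n} → Graph n → (k p q : ℕ) → Set
ProbGoodAtLeast {n} G k p q =
  Σ (List (Outcome n k)) λ L →
    Unique L × All (Good G k) L ×
    (numOutcomes n k ∸ length L) ^ q * k ^ p ≤ numOutcomes n k ^ q

module Submission where

-- Fix a vertex cover C, |C| ≤ k.  The outcome space is the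
-- list of all t = 100⌈log₂ k⌉-tuples of hash functions V → [b], b = 1000k.
-- Properties (i) and (ii) are reduced to finitely many tests, each asking that
-- fewer than r pairs of a list P of vertex pairs get equal colours: an edge
-- test (r = 1) for each edge uv with u ∈ C and u, v light, and a vertex test
-- (r = 2k) for each heavy u, which lies in C.  A pair collides with
-- probability ≤ 1/b and 2|P| ≤ rb, so by Markov a test fails with probability
-- ≤ 1/2, on all t samples with probability ≤ 2⁻ᵗ, and by the union bound over
-- ≤ 21k² tests some test always fails with probability ≤ 21k²/2ᵗ ≤ 1/k.  If
-- every test passes on some sample then, for ANY valid oracle answers, the
-- edge query for uv returns uv and the vertex queries return 2k distinct
-- neighbours of u.

open import Defs renaming (sym to adj-sym; irrefl to adj-irrefl)
open import Data.Nat hiding (_≟_)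
open import Data.Nat.Properties hiding (_≟_)
open import Data.Nat.Solver using (module +-*-Solver)
open import Algebra.Properties.CommutativeSemigroup +-commutativeSemigroup using () renaming (interchange to +-interchange)
open import Algebra.Properties.CommutativeSemigroup *-commutativeSemigroup using () renaming (interchange to *-interchange)
open import Data.Nat.Induction using (<-rec)
open import Data.Nat.Logarithm using (⌈log₂_⌉; ⌈log₂⌉-mono-≤; ⌈log₂2^n⌉≡n; ⌈log₂⌈n/2⌉⌉≡⌈log₂n⌉∸1)
open import Data.Bool using (Bool; true; false; not; _∧_; _∨_; T)
open import Data.Bool.Properties using (T-≡; T-∧)
open import Data.Bool.ListAction using (any)
open import Data.Empty using (⊥-elim)
open import Data.Fin using (Fin; zero; suc)
open import Data.Fin.Properties using (_≟_)
open import Data.Fin.Subset using (Subset; ∣_∣)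
open import Data.List using (List; []; _∷_; _++_; map; length; concat; concatMap; replicate; take; filterᵇ; allFin; cartesianProductWith)
open import Data.List.Properties using (length-map; length-++; length-take; length-filter; map-tabulate; length-tabulate)
open import Data.List.Membership.Propositional using (_∈_; lose)
open import Data.List.Membership.Propositional.Properties using (∈-filter⁻; ∈-filter⁺; ∈-map⁺; ∈-++⁺ˡ; ∈-++⁺ʳ; ∈-concat⁺′; ∈-allFin)
open import Data.List.Relation.Unary.All using (All; []; _∷_)
import Data.List.Relation.Unary.All as All
import Data.List.Relation.Unary.All.Properties as AllP
open import Data.List.Relation.Unary.Any using (here; there)
open import Data.List.Relation.Unary.Any.Properties using (any⁺)
open import Data.List.Relation.Unary.AllPairs using ([]; _∷_)
open import Data.List.Relation.Unary.Unique.Propositional using (Unique)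
import Data.List.Relation.Unary.Unique.Propositional.Properties as UniqueP
open import Data.Maybe using (just; nothing; maybe′)
open import Data.Product using (Σ; ∃; _×_; _,_; proj₁; proj₂)
open import Data.Sum using (_⊎_; inj₁; inj₂)
import Data.Sum as Sum
open import Data.Vec using (Vec; []; _∷_; lookup; tabulate)
open import Data.Vec.Properties using (∷-injective; []=⇒lookup; lookup∘tabulate)
open import Function using (_∘_; id; mk⇔; Equivalence)
open import Relation.Binary.PropositionalEquality
open import Relation.Nullary using (¬_; does; yes; no)
open import Relation.Nullary.Decidable using (T?; does-⇔; dec-true)

private variable
  A B C : Set
  b n : ℕ

-- Σ_{x ∈ xs} f x : a sum over a list, counted with multiplicity.  Finite
-- probability spaces are lists of equally likely outcomes, so expectations
-- and probabilities become such sums and counts.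
sumBy : (A → ℕ) → List A → ℕ
sumBy f []       = 0
sumBy f (x ∷ xs) = f x + sumBy f xs

sumBy-cong : ∀ {f g : A → ℕ} xs → All (λ x → f x ≡ g x) xs → sumBy f xs ≡ sumBy g xs
sumBy-cong []       []       = refl
sumBy-cong (x ∷ xs) (e ∷ es) = cong₂ _+_ e (sumBy-cong xs es)

sumBy-mono : ∀ {f g : A → ℕ} xs → All (λ x → f x ≤ g x) xs → sumBy f xs ≤ sumBy g xs
sumBy-mono []       []       = z≤n
sumBy-mono (x ∷ xs) (e ∷ es) = +-mono-≤ e (sumBy-mono xs es)

sumBy-++ : ∀ (f : A → ℕ) xs ys → sumBy f (xs ++ ys) ≡ sumBy f xs + sumBy f ys
sumBy-++ f []       ys = refl
sumBy-++ f (x ∷ xs) ys = trans (cong (f x +_) (sumBy-++ f xs ys)) (sym (+-assoc (f x) _ _))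

sumBy-map : ∀ (f : B → ℕ) (g : A → B) xs → sumBy f (map g xs) ≡ sumBy (λ x → f (g x)) xs
sumBy-map f g []       = refl
sumBy-map f g (x ∷ xs) = cong (f (g x) +_) (sumBy-map f g xs)

sumBy-concatMap : ∀ (f : B → ℕ) (g : A → List B) xs →
                  sumBy f (concatMap g xs) ≡ sumBy (λ x → sumBy f (g x)) xs
sumBy-concatMap f g []       = refl
sumBy-concatMap f g (x ∷ xs) =
  trans (sumBy-++ f (g x) (concatMap g xs)) (cong (sumBy f (g x) +_) (sumBy-concatMap f g xs))

sumBy-replicate : ∀ (f : A → ℕ) m xs → sumBy f (concat (replicate m xs)) ≡ m * sumBy f xs
sumBy-replicate f zero    xs = refl
sumBy-replicate f (suc m) xs =
  trans (sumBy-++ f xs (concat (replicate m xs))) (cong (sumBy f xs +_) (sumBy-replicate f m xs))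

sumBy-+ : ∀ (f g : A → ℕ) xs → sumBy (λ x → f x + g x) xs ≡ sumBy f xs + sumBy g xs
sumBy-+ f g []       = refl
sumBy-+ f g (x ∷ xs) =
  trans (cong (f x + g x +_) (sumBy-+ f g xs)) (+-interchange (f x) (g x) (sumBy f xs) (sumBy g xs))

sumBy-*ˡ : ∀ c (f : A → ℕ) xs → sumBy (λ x → c * f x) xs ≡ c * sumBy f xs
sumBy-*ˡ c f []       = sym (*-zeroʳ c)
sumBy-*ˡ c f (x ∷ xs) = trans (cong (c * f x +_) (sumBy-*ˡ c f xs)) (sym (*-distribˡ-+ c (f x) _))

sumBy-*ʳ : ∀ c (f : A → ℕ) xs → sumBy (λ x → f x * c) xs ≡ sumBy f xs * c
sumBy-*ʳ c f xs = begin
  sumBy (λ x → f x * c) xs ≡⟨ sumBy-cong xs (All.universal (λ x → *-comm (f x) c) xs) ⟩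
  sumBy (λ x → c * f x) xs ≡⟨ sumBy-*ˡ c f xs ⟩
  c * sumBy f xs           ≡⟨ *-comm c _ ⟩
  sumBy f xs * c           ∎
  where open ≡-Reasoning

sumBy-const : ∀ c (xs : List A) → sumBy (λ _ → c) xs ≡ length xs * c
sumBy-const c []       = refl
sumBy-const c (x ∷ xs) = cong (c +_) (sumBy-const c xs)

length-as-sum : ∀ (xs : List A) → length xs ≡ sumBy (λ _ → 1) xs
length-as-sum xs = sym (trans (sumBy-const 1 xs) (*-identityʳ (length xs)))

sumBy-swap : ∀ (g : A → B → ℕ) xs ys →
             sumBy (λ x → sumBy (g x) ys) xs ≡ sumBy (λ y → sumBy (λ x → g x y) xs) ys
sumBy-swap g []       ys = sym (trans (sumBy-const 0 ys) (*-zeroʳ (length ys)))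
sumBy-swap g (x ∷ xs) ys =
  trans (cong (sumBy (g x) ys +_) (sumBy-swap g xs ys)) (sym (sumBy-+ (g x) _ ys))

length-concatMap : ∀ (g : A → List B) xs → length (concatMap g xs) ≡ sumBy (λ x → length (g x)) xs
length-concatMap g xs = begin
  length (concatMap g xs)                              ≡⟨ length-as-sum (concatMap g xs) ⟩
  sumBy (λ _ → 1) (concatMap g xs)                      ≡⟨ sumBy-concatMap (λ _ → 1) g xs ⟩
  sumBy (λ x → sumBy (λ _ → 1) (g x)) xs               ≡⟨ sumBy-cong xs (All.universal (λ x → sym (length-as-sum (g x))) xs) ⟩
  sumBy (λ x → length (g x)) xs                         ∎
  where open ≡-Reasoning

length-concat-replicate : ∀ m (xs : List A) → length (concat (replicate m xs)) ≡ m * length xs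
length-concat-replicate m xs = begin
  length (concat (replicate m xs))           ≡⟨ length-as-sum (concat (replicate m xs)) ⟩
  sumBy (λ _ → 1) (concat (replicate m xs))  ≡⟨ sumBy-replicate (λ _ → 1) m xs ⟩
  m * sumBy (λ _ → 1) xs                     ≡⟨ cong (m *_) (sym (length-as-sum xs)) ⟩
  m * length xs                              ∎
  where open ≡-Reasoning

𝟙 : Bool → ℕ
𝟙 true  = 1
𝟙 false = 0

count : (A → Bool) → List A → ℕ
count f = sumBy (λ x → 𝟙 (f x))

T-not⇒¬T : ∀ {c} → T (not c) → ¬ T c
T-not⇒¬T {false} _ ()

¬T⇒T-not : ∀ {c} → ¬ T c → T (not c)
¬T⇒T-not {true}  ¬t = ¬t _
¬T⇒T-not {false} _  = _

¬T-not⇒T : ∀ {c} → ¬ T (not c) → T c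
¬T-not⇒T {true}  _   = _
¬T-not⇒T {false} ¬nc = ¬nc _

length-filterᵇ : ∀ (f : A → Bool) xs → length (filterᵇ f xs) ≡ count f xs
length-filterᵇ f []       = refl
length-filterᵇ f (x ∷ xs) with f x
... | true  = cong suc (length-filterᵇ f xs)
... | false = length-filterᵇ f xs

count-complement : ∀ (f : A → Bool) xs → count f xs + count (λ x → not (f x)) xs ≡ length xs
count-complement f xs = begin
  count f xs + count (λ x → not (f x)) xs ≡⟨ sym (sumBy-+ _ _ xs) ⟩
  sumBy (λ x → 𝟙 (f x) + 𝟙 (not (f x))) xs ≡⟨ sumBy-cong xs (All.universal one xs) ⟩
  sumBy (λ _ → 1) xs                        ≡⟨ sumBy-const 1 xs ⟩
  length xs * 1                             ≡⟨ *-identityʳ (length xs) ⟩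
  length xs                                 ∎
  where
  open ≡-Reasoning
  one : ∀ x → 𝟙 (f x) + 𝟙 (not (f x)) ≡ 1
  one x with f x
  ... | true  = refl
  ... | false = refl

length-filterᵇ-not : ∀ (f : A → Bool) xs → length xs ∸ length (filterᵇ (λ x → not (f x)) xs) ≡ count f xs
length-filterᵇ-not f xs = begin
  length xs ∸ length (filterᵇ (λ x → not (f x)) xs)
    ≡⟨ cong₂ _∸_ (sym (count-complement f xs)) (length-filterᵇ (λ x → not (f x)) xs) ⟩
  count f xs + count (λ x → not (f x)) xs ∸ count (λ x → not (f x)) xs
    ≡⟨ m+n∸n≡m (count f xs) (count (λ x → not (f x)) xs) ⟩
  count f xs ∎
  where open ≡-Reasoning

markov : ∀ (f : A → Bool) (g : A → ℕ) r xs → (∀ x → T (f x) → r ≤ g x) →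
         r * count f xs ≤ sumBy g xs
markov f g r xs bound =
  subst (_≤ sumBy g xs) (sumBy-*ˡ r (λ x → 𝟙 (f x)) xs) (sumBy-mono xs (All.universal pointwise xs))
  where
  pointwise : ∀ x → r * 𝟙 (f x) ≤ g x
  pointwise x with f x | bound x
  ... | true  | r≤gx = subst (_≤ g x) (sym (*-identityʳ r)) (r≤gx _)
  ... | false | _    = subst (_≤ g x) (sym (*-zeroʳ r)) z≤n

union-bound : ∀ {E : Set} (f : E → A → Bool) es xs →
              count (λ x → any (λ e → f e x) es) xs ≤ sumBy (λ e → count (f e) xs) es
union-bound f es xs =
  subst (count (λ x → any (λ e → f e x) es) xs ≤_) (sumBy-swap (λ x e → 𝟙 (f e x)) xs es)
        (sumBy-mono xs (All.universal (λ x → pointwise x es) xs))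
  where
  𝟙-∨ : ∀ a b → 𝟙 (a ∨ b) ≤ 𝟙 a + 𝟙 b
  𝟙-∨ true  b = s≤s z≤n
  𝟙-∨ false b = ≤-refl
  pointwise : ∀ x es → 𝟙 (any (λ e → f e x) es) ≤ sumBy (λ e → 𝟙 (f e x)) es
  pointwise x []       = z≤n
  pointwise x (e ∷ es) = ≤-trans (𝟙-∨ (f e x) _) (+-monoʳ-≤ (𝟙 (f e x)) (pointwise x es))

count-mono : ∀ (f g : A → Bool) xs → (∀ x → T (f x) → T (g x)) → count f xs ≤ count g xs
count-mono f g xs f⇒g = sumBy-mono xs (All.universal pointwise xs)
  where
  pointwise : ∀ x → 𝟙 (f x) ≤ 𝟙 (g x)
  pointwise x with f x | g x | f⇒g x
  ... | false | _     | _  = z≤n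
  ... | true  | true  | _  = ≤-refl
  ... | true  | false | fg = ⊥-elim (fg _)

count-split : ∀ (f g : A → Bool) xs → count f xs ≤ count (λ x → f x ∧ not (g x)) xs + count g xs
count-split f g xs = subst (count f xs ≤_) (sumBy-+ _ _ xs) (sumBy-mono xs (All.universal pointwise xs))
  where
  pointwise : ∀ x → 𝟙 (f x) ≤ 𝟙 (f x ∧ not (g x)) + 𝟙 (g x)
  pointwise x with f x | g x
  ... | true  | true  = s≤s z≤n
  ... | true  | false = s≤s z≤n
  ... | false | _     = z≤n

-- At most Σ g elements have g x > 0, so the rest have g x = 0.
few-nonzero : ∀ (g : A → ℕ) xs → length xs ≤ count (λ x → g x ≡ᵇ 0) xs + sumBy g xs
few-nonzero g []       = z≤n
few-nonzero g (x ∷ xs) with g x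
... | zero  = s≤s (few-nonzero g xs)
... | suc m = subst (suc (length xs) ≤_) (sym (+-suc _ _))
                (s≤s (≤-trans (few-nonzero g xs)
                              (+-monoʳ-≤ (count (λ x → g x ≡ᵇ 0) xs) (m≤n+m _ m))))

count-zero : ∀ (f : A → Bool) {x xs} → count f xs ≡ 0 → x ∈ xs → ¬ T (f x)
count-zero f {xs = y ∷ xs} none (here refl) with f y
... | false = λ ()
count-zero f {xs = y ∷ xs} none (there x∈) with f y
... | false = count-zero f none x∈

unique-map : ∀ (f : A → B) {xs} → Unique xs →
             (∀ {x y} → x ∈ xs → y ∈ xs → x ≢ y → f x ≢ f y) → Unique (map f xs)
unique-map f []         _   = []
unique-map f (x∉ ∷ uniq) inj =
  AllP.map⁺ (All.tabulate λ y∈ → inj (here refl) (there y∈) (All.lookup x∉ y∈))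
  ∷ unique-map f uniq (λ x∈ y∈ → inj (there x∈) (there y∈))

sumBy-cartesianProductWith : ∀ (F : C → ℕ) (f : A → B → C) xs ys →
  sumBy F (cartesianProductWith f xs ys) ≡ sumBy (λ x → sumBy (λ y → F (f x y)) ys) xs
sumBy-cartesianProductWith F f []       ys = refl
sumBy-cartesianProductWith F f (x ∷ xs) ys = begin
  sumBy F (map (f x) ys ++ cartesianProductWith f xs ys)
    ≡⟨ sumBy-++ F (map (f x) ys) _ ⟩
  sumBy F (map (f x) ys) + sumBy F (cartesianProductWith f xs ys)
    ≡⟨ cong₂ _+_ (sumBy-map F (f x) ys) (sumBy-cartesianProductWith F f xs ys) ⟩
  sumBy (λ y → F (f x y)) ys + sumBy (λ x → sumBy (λ y → F (f x y)) ys) xs ∎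
  where open ≡-Reasoning

vectors : List A → (n : ℕ) → List (Vec A n)
vectors xs zero    = [] ∷ []
vectors xs (suc n) = cartesianProductWith _∷_ xs (vectors xs n)

length-vectors : ∀ (xs : List A) n → length (vectors xs n) ≡ length xs ^ n
length-vectors xs zero    = refl
length-vectors xs (suc n) = begin
  length (vectors xs (suc n))                                  ≡⟨ length-as-sum (vectors xs (suc n)) ⟩
  sumBy (λ _ → 1) (vectors xs (suc n))                         ≡⟨ sumBy-cartesianProductWith _ _∷_ xs (vectors xs n) ⟩
  sumBy (λ _ → sumBy (λ _ → 1) (vectors xs n)) xs             ≡⟨ sumBy-const _ xs ⟩
  length xs * sumBy (λ _ → 1) (vectors xs n)                   ≡⟨ cong (length xs *_) (sym (length-as-sum (vectors xs n))) ⟩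
  length xs * length (vectors xs n)                            ≡⟨ cong (length xs *_) (length-vectors xs n) ⟩
  length xs ^ suc n                                            ∎
  where open ≡-Reasoning

vectors-unique : ∀ {xs : List A} n → Unique xs → Unique (vectors xs n)
vectors-unique zero    _     = [] ∷ []
vectors-unique (suc n) xs-un = UniqueP.cartesianProductWith⁺ _∷_ ∷-injective xs-un (vectors-unique n xs-un)

every : ∀ {m} → (A → Bool) → Vec A m → Bool
every F []      = true
every F (x ∷ v) = F x ∧ every F v

every-false : ∀ {m} (F : A → Bool) (v : Vec A m) → ¬ T (every F v) → ∃ λ s → ¬ T (F (lookup v s))
every-false F []      not-all = ⊥-elim (not-all _)
every-false F (x ∷ v) not-all with F x in Fx
... | false = zero , λ pass → subst T Fx pass
... | true  with every-false F v not-all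
...   | s , fails = suc s , fails

-- Independence of the coordinates: Pr[all n coordinates pass] = Pr[pass]ⁿ.
count-every : ∀ (F : A → Bool) xs n → count (every F) (vectors xs n) ≡ count F xs ^ n
count-every F xs zero    = refl
count-every F xs (suc n) = begin
  count (every F) (vectors xs (suc n))
    ≡⟨ sumBy-cartesianProductWith _ _∷_ xs (vectors xs n) ⟩
  sumBy (λ x → sumBy (λ v → 𝟙 (F x ∧ every F v)) (vectors xs n)) xs
    ≡⟨ sumBy-cong xs (All.universal factor xs) ⟩
  sumBy (λ x → 𝟙 (F x) * count (every F) (vectors xs n)) xs
    ≡⟨ sumBy-*ʳ (count (every F) (vectors xs n)) (λ x → 𝟙 (F x)) xs ⟩
  count F xs * count (every F) (vectors xs n)
    ≡⟨ cong (count F xs *_) (count-every F xs n) ⟩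
  count F xs ^ suc n ∎
  where
  open ≡-Reasoning
  factor : ∀ x → sumBy (λ v → 𝟙 (F x ∧ every F v)) (vectors xs n) ≡ 𝟙 (F x) * count (every F) (vectors xs n)
  factor x with F x
  ... | true  = sym (+-identityʳ _)
  ... | false = trans (sumBy-const 0 (vectors xs n)) (*-zeroʳ (length (vectors xs n)))

*-^ : ∀ a c t → (a * c) ^ t ≡ a ^ t * c ^ t
*-^ a c zero    = refl
*-^ a c (suc t) = trans (cong (a * c *_) (*-^ a c t)) (*-interchange a c (a ^ t) (c ^ t))

amplification : ∀ {E : Set} (fails : E → A → Bool) es xs t →
  All (λ e → count (fails e) xs * 2 ≤ length xs) es →
  count (λ ω → any (λ e → every (fails e) ω) es) (vectors xs t) * 2 ^ t ≤ length es * length xs ^ t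
amplification fails es xs t half = begin
  count (λ ω → any (λ e → every (fails e) ω) es) (vectors xs t) * 2 ^ t
    ≤⟨ *-monoˡ-≤ (2 ^ t) (union-bound (λ e → every (fails e)) es (vectors xs t)) ⟩
  sumBy (λ e → count (every (fails e)) (vectors xs t)) es * 2 ^ t
    ≡⟨ cong (_* 2 ^ t) (sumBy-cong es (All.universal (λ e → count-every (fails e) xs t) es)) ⟩
  sumBy (λ e → count (fails e) xs ^ t) es * 2 ^ t
    ≡⟨ sym (sumBy-*ʳ (2 ^ t) _ es) ⟩
  sumBy (λ e → count (fails e) xs ^ t * 2 ^ t) es
    ≤⟨ sumBy-mono es (All.map (λ half-e → ≤-trans (≤-reflexive (sym (*-^ _ 2 t))) (^-monoˡ-≤ t half-e)) half) ⟩
  sumBy (λ e → length xs ^ t) es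
    ≡⟨ sumBy-const _ es ⟩
  length es * length xs ^ t ∎
  where open ≤-Reasoning

_==_ : ∀ {m} → Fin m → Fin m → Bool
x == y = does (x ≟ y)

==-sym : ∀ {m} (x y : Fin m) → (x == y) ≡ (y == x)
==-sym x y = does-⇔ (mk⇔ sym sym) (x ≟ y) (y ≟ x)

sumBy-allFin-suc : ∀ {m} (f : Fin (suc m) → ℕ) → sumBy f (allFin (suc m)) ≡ f zero + sumBy (λ x → f (suc x)) (allFin m)
sumBy-allFin-suc {m} f =
  cong (f zero +_) (trans (cong (sumBy f) (sym (map-tabulate id suc))) (sumBy-map f suc (allFin m)))

count-colour : ∀ {m} (x : Fin m) → count (_== x) (allFin m) ≡ 1
count-colour {suc m} zero    =
  trans (sumBy-allFin-suc {m} (λ y → 𝟙 (y == zero))) (cong suc (trans (sumBy-const 0 (allFin m)) (*-zeroʳ (length (allFin m)))))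
count-colour {suc m} (suc x) = trans (sumBy-allFin-suc {m} (λ y → 𝟙 (y == suc x))) (count-colour x)

hashes : ∀ b n → List (Hash n b)
hashes b n = vectors (allFin b) n

length-hashes : ∀ b n → length (hashes b n) ≡ b ^ n
length-hashes b n = trans (length-vectors (allFin b) n) (cong (_^ n) (length-tabulate {n = b} id))

sum-over-colours : ∀ b (t : Fin b → ℕ) K → (∀ y → t y * b ≡ K) → sumBy t (allFin b) * b ≡ b * K
sum-over-colours b t K each = begin
  sumBy t (allFin b) * b          ≡⟨ sym (sumBy-*ʳ b t (allFin b)) ⟩
  sumBy (λ y → t y * b) (allFin b) ≡⟨ sumBy-cong (allFin b) (All.universal each (allFin b)) ⟩
  sumBy (λ _ → K) (allFin b)      ≡⟨ sumBy-const K (allFin b) ⟩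
  length (allFin b) * K           ≡⟨ cong (_* K) (length-tabulate {n = b} id) ⟩
  b * K                           ∎
  where open ≡-Reasoning

colour-probability : ∀ (c : Fin n) (x : Fin b) → count (λ h → lookup h c == x) (hashes b n) * b ≡ b ^ n
colour-probability {suc m} {b} zero x = begin
  count (λ h → lookup h zero == x) (hashes b (suc m)) * b
    ≡⟨ cong (_* b) (sumBy-cartesianProductWith _ _∷_ (allFin b) (hashes b m)) ⟩
  sumBy (λ y → sumBy (λ _ → 𝟙 (y == x)) (hashes b m)) (allFin b) * b
    ≡⟨ cong (_* b) (sumBy-cong (allFin b) (All.universal (λ y → sumBy-const _ (hashes b m)) (allFin b))) ⟩
  sumBy (λ y → length (hashes b m) * 𝟙 (y == x)) (allFin b) * b
    ≡⟨ cong (_* b) (sumBy-*ˡ (length (hashes b m)) (λ y → 𝟙 (y == x)) (allFin b)) ⟩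
  length (hashes b m) * count (_== x) (allFin b) * b
    ≡⟨ cong (λ z → length (hashes b m) * z * b) (count-colour x) ⟩
  length (hashes b m) * 1 * b
    ≡⟨ cong (λ z → z * 1 * b) (length-hashes b m) ⟩
  b ^ m * 1 * b
    ≡⟨ cong (_* b) (*-identityʳ (b ^ m)) ⟩
  b ^ m * b
    ≡⟨ *-comm (b ^ m) b ⟩
  b ^ suc m ∎
  where open ≡-Reasoning
colour-probability {suc m} {b} (suc c) x =
  trans (cong (_* b) (sumBy-cartesianProductWith _ _∷_ (allFin b) (hashes b m)))
        (sum-over-colours b _ _ (λ _ → colour-probability c x))

pair-probability : ∀ (a c : Fin n) → a ≢ c → count (λ h → lookup h a == lookup h c) (hashes b n) * b ≡ b ^ n
pair-probability zero zero a≢c = ⊥-elim (a≢c refl)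
pair-probability {suc m} {b} zero (suc c) _ =
  trans (cong (_* b) (sumBy-cartesianProductWith _ _∷_ (allFin b) (hashes b m)))
        (sum-over-colours b _ _ λ y →
          trans (cong (_* b) (sumBy-cong (hashes b m)
                   (All.universal (λ h → cong 𝟙 (==-sym y (lookup h c))) (hashes b m))))
                (colour-probability c y))
pair-probability {suc m} {b} (suc a) zero _ =
  trans (cong (_* b) (sumBy-cartesianProductWith _ _∷_ (allFin b) (hashes b m)))
        (sum-over-colours b _ _ (λ y → colour-probability a y))
pair-probability {suc m} {b} (suc a) (suc c) a≢c =
  trans (cong (_* b) (sumBy-cartesianProductWith _ _∷_ (allFin b) (hashes b m)))
        (sum-over-colours b _ _ (λ _ → pair-probability a c (λ a≡c → a≢c (cong suc a≡c))))

Pair : ℕ → Set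
Pair n = Fin n × Fin n

collides : Hash n b → Pair n → Bool
collides h (a , c) = not (a == c) ∧ (lookup h a == lookup h c)

collisions : Hash n b → List (Pair n) → ℕ
collisions h P = count (collides h) P

collision-probability : ∀ (p : Pair n) → count (λ h → collides h p) (hashes b n) * b ≤ b ^ n
collision-probability {n} {b} (a , c) with a ≟ c
... | yes _   = ≤-trans (≤-reflexive (cong (_* b) never)) z≤n
  where never = trans (sumBy-const 0 (hashes b n)) (*-zeroʳ (length (hashes b n)))
... | no a≢c = ≤-reflexive (pair-probability a c a≢c)

expected-collisions : ∀ (P : List (Pair n)) → sumBy (λ h → collisions h P) (hashes b n) * b ≤ length P * b ^ n
expected-collisions {n} {b} P = begin
  sumBy (λ h → collisions h P) (hashes b n) * b
    ≡⟨ cong (_* b) (sumBy-swap (λ h p → 𝟙 (collides h p)) (hashes b n) P) ⟩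
  sumBy (λ p → count (λ h → collides h p) (hashes b n)) P * b
    ≡⟨ sym (sumBy-*ʳ b _ P) ⟩
  sumBy (λ p → count (λ h → collides h p) (hashes b n) * b) P
    ≤⟨ sumBy-mono P (All.universal collision-probability P) ⟩
  sumBy (λ _ → b ^ n) P
    ≡⟨ sumBy-const _ P ⟩
  length P * b ^ n ∎
  where open ≤-Reasoning

collision-free : ∀ {h : Hash n b} {P a c} → collisions h P ≡ 0 → (a , c) ∈ P →
                 lookup h a ≡ lookup h c → a ≡ c
collision-free {h = h} {a = a} {c} none ac∈P same with a ≟ c | count-zero (collides h) none ac∈P
... | yes a≡c | _            = a≡c
... | no _    | no-collision = ⊥-elim (no-collision (Equivalence.from T-≡ (dec-true (lookup h a ≟ lookup h c) same)))

record Test (n : ℕ) : Set where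
  field
    pairs     : List (Pair n)
    threshold : ℕ
open Test public

passes : Test n → Hash n b → Bool
passes τ h = collisions h (pairs τ) <ᵇ threshold τ

-- The threshold is positive and at least twice the expected number of
-- collisions (for b colours).
Admissible : ℕ → Test n → Set
Admissible b τ = 1 ≤ threshold τ × 2 * length (pairs τ) ≤ threshold τ * b

-- By Markov's inequality an admissible test fails with probability ≤ 1/2.
failure-probability : ∀ (τ : Test n) → 1 ≤ b → Admissible b τ →
                      count (λ h → not (passes τ h)) (hashes b n) * 2 ≤ length (hashes b n)
failure-probability {n} {b} τ 1≤b (1≤r , small) =
  subst (F * 2 ≤_) (sym (length-hashes b n)) (*-cancelˡ-≤ (r * b) {{>-nonZero (*-mono-≤ 1≤r 1≤b)}} chain)
  where
  P : List (Pair n)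
  P = pairs τ
  r : ℕ
  r = threshold τ
  F : ℕ
  F = count (λ h → not (passes τ h)) (hashes b n)
  S : ℕ
  S = sumBy (λ h → collisions h P) (hashes b n)
  fails⇒many : ∀ h → T (not (passes τ h)) → r ≤ collisions h P
  fails⇒many h fails = ≮⇒≥ λ few → T-not⇒¬T fails (<⇒<ᵇ few)
  open +-*-Solver
  chain : r * b * (F * 2) ≤ r * b * b ^ n
  chain = begin
    r * b * (F * 2)    ≡⟨ solve 3 (λ r b F → r :* b :* (F :* con 2) := r :* F :* b :* con 2) refl r b F ⟩
    r * F * b * 2      ≤⟨ *-monoˡ-≤ 2 (*-monoˡ-≤ b (markov _ _ r (hashes b n) fails⇒many)) ⟩
    S * b * 2          ≤⟨ *-monoˡ-≤ 2 (expected-collisions P) ⟩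
    length P * b ^ n * 2 ≡⟨ solve 2 (λ l B → l :* B :* con 2 := con 2 :* l :* B) refl (length P) (b ^ n) ⟩
    2 * length P * b ^ n ≤⟨ *-monoˡ-≤ (b ^ n) small ⟩
    r * b * b ^ n      ∎
    where open ≤-Reasoning

samples : ∀ b n t → List (Vec (Hash n b) t)
samples b n t = vectors (hashes b n) t

someTestFailsAlways : ∀ {t} → List (Test n) → Vec (Hash n b) t → Bool
someTestFailsAlways τs ω = any (λ τ → every (λ h → not (passes τ h)) ω) τs

bad-event-probability : ∀ b n t (τs : List (Test n)) → 1 ≤ b → All (Admissible b) τs →
  count (someTestFailsAlways τs) (samples b n t) * 2 ^ t ≤ length τs * (b ^ n) ^ t
bad-event-probability b n t τs 1≤b admissible =
  subst (λ N → count (someTestFailsAlways τs) (samples b n t) * 2 ^ t ≤ length τs * N ^ t)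
        (length-hashes b n)
        (amplification (λ τ h → not (passes τ h)) τs (hashes b n) t
                       (All.map (λ {τ} → failure-probability τ 1≤b) admissible))

passes-somewhere : ∀ {t} {τs : List (Test n)} (ω : Vec (Hash n b) t) →
  ¬ T (someTestFailsAlways τs ω) → ∀ {τ} → τ ∈ τs → ∃ λ s → T (passes τ (lookup ω s))
passes-somewhere ω good τ∈τs with every-false _ ω (λ fails → good (any⁺ _ (lose τ∈τs fails)))
... | s , not-failing = s , ¬T-not⇒T not-failing

-- k ≤ 2^⌈log₂ k⌉, by strong induction: for k ≥ 2, with h = ⌈k/2⌉ we have
-- ⌈log₂ k⌉ = 1 + ⌈log₂ h⌉ and k ≤ 2h.
≤2^⌈log₂⌉ : ∀ k → k ≤ 2 ^ ⌈log₂ k ⌉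
≤2^⌈log₂⌉ = <-rec (λ k → k ≤ 2 ^ ⌈log₂ k ⌉) step
  where
  step : ∀ k → (∀ {m} → m < k → m ≤ 2 ^ ⌈log₂ m ⌉) → k ≤ 2 ^ ⌈log₂ k ⌉
  step zero            _  = z≤n
  step (suc zero)      _  = s≤s z≤n
  step k@(suc (suc m)) ih = subst (λ e → k ≤ 2 ^ e) log-k (begin
    k                             ≤⟨ k≤h+h ⟩
    h + h                         ≤⟨ +-mono-≤ (ih (⌈n/2⌉<n m)) (ih (⌈n/2⌉<n m)) ⟩
    2 ^ ⌈log₂ h ⌉ + 2 ^ ⌈log₂ h ⌉ ≡⟨ cong (2 ^ ⌈log₂ h ⌉ +_) (sym (+-identityʳ _)) ⟩
    2 ^ suc ⌈log₂ h ⌉             ∎)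
    where
    open ≤-Reasoning
    h : ℕ
    h = ⌈ k /2⌉
    k≤h+h : k ≤ h + h
    k≤h+h = subst (_≤ h + h) (⌊n/2⌋+⌈n/2⌉≡n k) (+-monoˡ-≤ h (⌊n/2⌋≤⌈n/2⌉ k))
    1≤⌈log₂k⌉ : 1 ≤ ⌈log₂ k ⌉
    1≤⌈log₂k⌉ = subst (_≤ ⌈log₂ k ⌉) (⌈log₂2^n⌉≡n 1) (⌈log₂⌉-mono-≤ {2} {k} (s≤s (s≤s z≤n)))
    log-k : suc ⌈log₂ h ⌉ ≡ ⌈log₂ k ⌉
    log-k = trans (cong suc (⌈log₂⌈n/2⌉⌉≡⌈log₂n⌉∸1 k)) (m+[n∸m]≡n 1≤⌈log₂k⌉)

-- The number of samples suffices: e tests with e ≤ 21k² fail jointly with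
-- probability at most e / 2^(100⌈log₂ k⌉) ≤ 1/k.
enough-samples : ∀ k e → 2 ≤ k → e ≤ 21 * (k * k) → e * k ≤ 2 ^ (100 * ⌈log₂ k ⌉)
enough-samples k e 2≤k e≤21k² = begin
  e * k                   ≤⟨ *-monoˡ-≤ k e≤21k² ⟩
  21 * (k * k) * k        ≡⟨ solve 1 (λ k → con 21 :* (k :* k) :* k := con 21 :* (k :^ 3)) refl k ⟩
  21 * k ^ 3              ≤⟨ *-monoˡ-≤ (k ^ 3) 21≤k⁹⁷ ⟩
  k ^ 97 * k ^ 3          ≡⟨ sym (^-distribˡ-+-* k 97 3) ⟩
  k ^ 100                 ≤⟨ ^-monoˡ-≤ 100 (≤2^⌈log₂⌉ k) ⟩
  (2 ^ ⌈log₂ k ⌉) ^ 100   ≡⟨ ^-*-assoc 2 ⌈log₂ k ⌉ 100 ⟩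
  2 ^ (⌈log₂ k ⌉ * 100)   ≡⟨ cong (2 ^_) (*-comm ⌈log₂ k ⌉ 100) ⟩
  2 ^ (100 * ⌈log₂ k ⌉)   ∎
  where
  open ≤-Reasoning
  open +-*-Solver
  instance
    k≢0 : NonZero k
    k≢0 = >-nonZero (≤-trans (s≤s z≤n) 2≤k)
  21≤k⁹⁷ : 21 ≤ k ^ 97
  21≤k⁹⁷ = ≤-trans (m≤m+n 21 11) (≤-trans (^-monoˡ-≤ 5 2≤k) (^-monoʳ-≤ k (m≤m+n 5 92)))

_⊗_ : Fin n → List (Fin n) → List (Pair n)
x ⊗ ys = map (x ,_) ys

subset-size : (S : Subset n) → ∣ S ∣ ≡ count (lookup S) (allFin n)
subset-size []          = refl
subset-size (true ∷ S)  = trans (cong suc (subset-size S)) (sym (sumBy-allFin-suc (λ x → 𝟙 (lookup (true ∷ S) x))))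
subset-size (false ∷ S) = trans (subset-size S) (sym (sumBy-allFin-suc (λ x → 𝟙 (lookup (false ∷ S) x))))

∈-concatMap⁺ : ∀ {B : Set} (g : A → List B) {x xs y} → y ∈ g x → x ∈ xs → y ∈ concatMap g xs
∈-concatMap⁺ g y∈ x∈ = ∈-concat⁺′ y∈ (∈-map⁺ g x∈)

Returned : ∀ {b} → Answers n b → Fin n → Fin n → Set
Returned {b = b} a u v = ∃ λ (i : Fin b) → ∃ λ (j : Fin b) → i ≢ j × a i j ≡ just (u , v)

returned⇒edge : ∀ {b t} {ans : Fin t → Answers n b} s {u v} → Returned (ans s) u v → HatEdge ans u v
returned⇒edge s (i , j , i≢j , answer) = s , i , j , i≢j , inj₁ answer

ReturnedNeighbours : ∀ {b} → Answers n b → Fin n → ℕ → Set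
ReturnedNeighbours {n} a u d = Σ (List (Fin n)) λ L → Unique L × All (Returned a u) L × d ≤ length L

returned⇒degree : ∀ {b t d} {ans : Fin t → Answers n b} s {u} → ReturnedNeighbours (ans s) u d → HatDegree≥ ans u d
returned⇒degree s (L , unique , returned , many) = L , unique , All.map (returned⇒edge s) returned , many

-- If X + m·c < m then c = 0 and X < m: a positive c weighted by m already
-- reaches m.
weighted-small : ∀ X c m → X + m * c < m → c ≡ 0 × X < m
weighted-small X zero    m lt = refl , subst (_< m) (trans (cong (X +_) (*-zeroʳ m)) (+-identityʳ X)) lt
weighted-small X (suc c) m lt = ⊥-elim (<⇒≱ lt (≤-trans (m≤m*n m (suc c)) (m≤n+m (m * suc c) X)))

module Tests (G : Graph n) (k : ℕ) (C : Subset n) where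

  inCover : Fin n → Bool
  inCover = lookup C

  cover : List (Fin n)
  cover = filterᵇ inCover (allFin n)

  nbrs : Fin n → List (Fin n)
  nbrs u = filterᵇ (adj G u) (allFin n)

  light : Fin n → Bool
  light u = degree G u <ᵇ 20 * k

  -- For an edge uv of light vertices (u ∈ C): no collision between u or v
  -- and any cover vertex or neighbour of the other endpoint, nor between u
  -- and v.  Then the query (V_h(u), V_h(v)) can only return the edge uv.
  edgeTest : Fin n → Fin n → Test n
  edgeTest u v = record
    { pairs     = (u , v) ∷ (u ⊗ (cover ++ nbrs v) ++ v ⊗ (cover ++ nbrs u))
    ; threshold = 1 }

  witnesses : Fin n → List (Fin n)
  witnesses u = take (4 * k) (filterᵇ (λ w → adj G u w ∧ not (inCover w)) (allFin n))

  -- For a heavy cover vertex u: each witness w whose colour class contains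
  -- no other witness and no cover vertex yields an edge at u; the pairs of u
  -- with the cover are repeated 2k times so that passing forces none of
  -- them to collide.
  vertexTest : Fin n → Test n
  vertexTest u = record
    { pairs     = concatMap (λ w → w ⊗ (witnesses u ++ cover)) (witnesses u)
                  ++ concat (replicate (2 * k) (u ⊗ cover))
    ; threshold = 2 * k }

  tests : List (Test n)
  tests = concatMap (λ c → map (edgeTest c) (filterᵇ light (nbrs c))) (filterᵇ light cover)
          ++ map vertexTest (filterᵇ (not ∘ light) cover)

  length-cover : ∣ C ∣ ≤ k → length cover ≤ k
  length-cover |C|≤k = subst (_≤ k) (trans (subset-size C) (sym (length-filterᵇ inCover (allFin n)))) |C|≤k

  length-nbrs : ∀ u → length (nbrs u) ≡ degree G u
  length-nbrs u = begin
    length (nbrs u)                                    ≡⟨ length-filterᵇ (adj G u) (allFin n) ⟩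
    count (adj G u) (allFin n)                         ≡⟨ sumBy-cong (allFin n) (All.universal (λ w → cong 𝟙 (sym (lookup∘tabulate (adj G u) w))) (allFin n)) ⟩
    count (lookup (tabulate (adj G u))) (allFin n)     ≡⟨ sym (subset-size (tabulate (adj G u))) ⟩
    degree G u                                         ∎
    where open ≡-Reasoning

  length-light-nbrs : ∀ u → T (light u) → length (nbrs u) ≤ 20 * k
  length-light-nbrs u light-u = subst (_≤ 20 * k) (sym (length-nbrs u)) (<⇒≤ (<ᵇ⇒< _ _ light-u))

  length-⊗ : ∀ (x : Fin n) ys → length (x ⊗ ys) ≡ length ys
  length-⊗ x ys = length-map (x ,_) ys

  length-⊗-++ : ∀ (x : Fin n) ys zs → length (x ⊗ (ys ++ zs)) ≡ length ys + length zs
  length-⊗-++ x ys zs = trans (length-⊗ x (ys ++ zs)) (length-++ ys)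

  length-witnesses : ∀ u → length (witnesses u) ≤ 4 * k
  length-witnesses u = ≤-trans (≤-reflexive (length-take (4 * k) _)) (m⊓n≤m _ _)

  module Sizes (|C|≤k : ∣ C ∣ ≤ k) (1≤k : 1 ≤ k) where
    open +-*-Solver

    edgeTest-admissible : ∀ u v → T (light u) → T (light v) → Admissible (1000 * k) (edgeTest u v)
    edgeTest-admissible u v light-u light-v = ≤-refl , (begin
      2 * length (pairs (edgeTest u v))
        ≡⟨ cong (λ l → 2 * suc l) (trans (length-++ (u ⊗ (cover ++ nbrs v))) (cong₂ _+_ (length-⊗-++ u cover (nbrs v)) (length-⊗-++ v cover (nbrs u)))) ⟩
      2 * suc ((length cover + length (nbrs v)) + (length cover + length (nbrs u)))
        ≤⟨ *-monoʳ-≤ 2 (s≤s (+-mono-≤ (+-mono-≤ |cover| (length-light-nbrs v light-v)) (+-mono-≤ |cover| (length-light-nbrs u light-u)))) ⟩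
      2 * suc ((k + 20 * k) + (k + 20 * k))
        ≡⟨ solve 1 (λ k → con 2 :* (con 1 :+ ((k :+ con 20 :* k) :+ (k :+ con 20 :* k))) := con 2 :+ con 84 :* k) refl k ⟩
      2 + 84 * k
        ≤⟨ +-monoˡ-≤ (84 * k) (*-monoʳ-≤ 2 1≤k) ⟩
      2 * k + 84 * k
        ≡⟨ sym (*-distribʳ-+ k 2 84) ⟩
      86 * k
        ≤⟨ *-monoˡ-≤ k (m≤m+n 86 914) ⟩
      1000 * k
        ≡⟨ sym (*-identityˡ (1000 * k)) ⟩
      1 * (1000 * k) ∎)
      where
      open ≤-Reasoning
      |cover| : length cover ≤ k
      |cover| = length-cover |C|≤k

    vertexTest-admissible : ∀ u → Admissible (1000 * k) (vertexTest u)
    vertexTest-admissible u = ≤-trans 1≤k (m≤m+n k (k + 0)) , (begin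
      2 * length (pairs (vertexTest u))
        ≡⟨ cong (2 *_) (trans (length-++ (concatMap (λ w → w ⊗ (W ++ cover)) W))
                              (cong₂ _+_ (length-concatMap (λ w → w ⊗ (W ++ cover)) W) (length-concat-replicate (2 * k) (u ⊗ cover)))) ⟩
      2 * (sumBy (λ w → length (w ⊗ (W ++ cover))) W + 2 * k * length (u ⊗ cover))
        ≡⟨ cong₂ (λ x y → 2 * (x + 2 * k * y)) (sumBy-cong W (All.universal (λ w → length-⊗-++ w W cover) W)) (length-⊗ u cover) ⟩
      2 * (sumBy (λ _ → length W + length cover) W + 2 * k * length cover)
        ≡⟨ cong (λ x → 2 * (x + 2 * k * length cover)) (sumBy-const _ W) ⟩
      2 * (length W * (length W + length cover) + 2 * k * length cover)
        ≤⟨ *-monoʳ-≤ 2 (+-mono-≤ (*-mono-≤ |W| (+-mono-≤ |W| |cover|)) (*-monoʳ-≤ (2 * k) |cover|)) ⟩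
      2 * (4 * k * (4 * k + k) + 2 * k * k)
        ≡⟨ solve 1 (λ k → con 2 :* (con 4 :* k :* (con 4 :* k :+ k) :+ con 2 :* k :* k) := con 44 :* (k :* k)) refl k ⟩
      44 * (k * k)
        ≤⟨ *-monoˡ-≤ (k * k) (m≤m+n 44 1956) ⟩
      2000 * (k * k)
        ≡⟨ solve 1 (λ k → con 2000 :* (k :* k) := con 2 :* k :* (con 1000 :* k)) refl k ⟩
      2 * k * (1000 * k) ∎)
      where
      open ≤-Reasoning
      W : List (Fin n)
      W = witnesses u
      |W| : length W ≤ 4 * k
      |W| = length-witnesses u
      |cover| : length cover ≤ k
      |cover| = length-cover |C|≤k

    length-tests : length tests ≤ 21 * (k * k)
    length-tests = begin
      length tests
        ≡⟨ length-++ edgeTests ⟩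
      length edgeTests + length vertexTests
        ≡⟨ cong₂ _+_ (length-concatMap _ lightCover) (length-map vertexTest heavyCover) ⟩
      sumBy (λ c → length (map (edgeTest c) (filterᵇ light (nbrs c)))) lightCover + length heavyCover
        ≤⟨ +-mono-≤ (sumBy-mono lightCover (All.map per-vertex (AllP.all-filter (T? ∘ light) cover)))
                    (≤-trans (length-filter (T? ∘ (not ∘ light)) cover) |cover|) ⟩
      sumBy (λ _ → 20 * k) lightCover + k
        ≡⟨ cong (_+ k) (sumBy-const (20 * k) lightCover) ⟩
      length lightCover * (20 * k) + k
        ≤⟨ +-mono-≤ (*-monoˡ-≤ (20 * k) (≤-trans (length-filter (T? ∘ light) cover) |cover|)) (m≤m*n k k {{>-nonZero 1≤k}}) ⟩
      k * (20 * k) + k * k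
        ≡⟨ solve 1 (λ k → k :* (con 20 :* k) :+ k :* k := con 21 :* (k :* k)) refl k ⟩
      21 * (k * k) ∎
      where
      open ≤-Reasoning
      |cover| : length cover ≤ k
      |cover| = length-cover |C|≤k
      lightCover : List (Fin n)
      lightCover = filterᵇ light cover
      heavyCover : List (Fin n)
      heavyCover = filterᵇ (not ∘ light) cover
      edgeTests : List (Test n)
      edgeTests = concatMap (λ c → map (edgeTest c) (filterᵇ light (nbrs c))) lightCover
      vertexTests : List (Test n)
      vertexTests = map vertexTest heavyCover
      per-vertex : ∀ {c} → T (light c) → length (map (edgeTest c) (filterᵇ light (nbrs c))) ≤ 20 * k
      per-vertex {c} light-c = ≤-trans (≤-reflexive (length-map (edgeTest c) (filterᵇ light (nbrs c))))
                                 (≤-trans (length-filter (T? ∘ light) (nbrs c)) (length-light-nbrs c light-c))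

    tests-admissible : All (Admissible (1000 * k)) tests
    tests-admissible = AllP.++⁺
      (AllP.concat⁺ (AllP.map⁺ (All.map (λ {c} light-c → AllP.map⁺ (All.map (λ {v} light-v → edgeTest-admissible c v light-c light-v)
                                                                          (AllP.all-filter (T? ∘ light) (nbrs c))))
                                        (AllP.all-filter (T? ∘ light) cover))))
      (AllP.map⁺ (All.universal vertexTest-admissible _))

  cover-∈ : ∀ {c} → T (inCover c) → c ∈ cover
  cover-∈ {c} c∈C = ∈-filter⁺ (T? ∘ inCover) (∈-allFin c) c∈C

  nbrs-∈ : ∀ {u v} → Edge G u v → v ∈ nbrs u
  nbrs-∈ {u} {v} uv = ∈-filter⁺ (T? ∘ adj G u) (∈-allFin v) (Equivalence.from T-≡ uv)

  witness-facts : ∀ {u w} → w ∈ witnesses u → Edge G u w × ¬ T (inCover w)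
  witness-facts {u} w∈ with Equivalence.to T-∧ (All.lookup (AllP.take⁺ (4 * k) (AllP.all-filter (T? ∘ λ w → adj G u w ∧ not (inCover w)) (allFin n))) w∈)
  ... | uw , w∉C = Equivalence.to T-≡ uw , T-not⇒¬T w∉C

  witnesses-unique : ∀ u → Unique (witnesses u)
  witnesses-unique u = UniqueP.take⁺ (4 * k) (UniqueP.filter⁺ (T? ∘ λ w → adj G u w ∧ not (inCover w)) (UniqueP.allFin⁺ n))

  module Soundness (|C|≤k : ∣ C ∣ ≤ k) (1≤k : 1 ≤ k)
               (isCover : ∀ u v → Edge G u v → T (inCover u) ⊎ T (inCover v)) where

    k<20k : k < 20 * k
    k<20k = subst (_< 20 * k) (*-identityˡ k) (*-monoˡ-< k {{>-nonZero 1≤k}} {1} {20} (s≤s (s≤s z≤n)))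

    count-cover : count inCover (allFin n) ≤ k
    count-cover = subst (_≤ k) (subset-size C) |C|≤k

    -- A vertex outside the cover has all its ≤ k neighbours in the cover.
    heavy-in-cover : ∀ u → 20 * k ≤ degree G u → T (inCover u)
    heavy-in-cover u heavy with inCover u in u∈?
    ... | true  = _
    ... | false = ⊥-elim (<⇒≱ k<20k (begin
      20 * k                     ≤⟨ heavy ⟩
      degree G u                 ≡⟨ sym (length-nbrs u) ⟩
      length (nbrs u)            ≡⟨ length-filterᵇ (adj G u) (allFin n) ⟩
      count (adj G u) (allFin n) ≤⟨ count-mono (adj G u) inCover (allFin n) nbrs-in-cover ⟩
      count inCover (allFin n)   ≤⟨ count-cover ⟩
      k                          ∎))
      where
      open ≤-Reasoning
      nbrs-in-cover : ∀ v → T (adj G u v) → T (inCover v)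
      nbrs-in-cover v uv with isCover u v (Equivalence.to T-≡ uv)
      ... | inj₁ u∈C = ⊥-elim (subst T u∈? u∈C)
      ... | inj₂ v∈C = v∈C

    -- A heavy vertex has at least 19k ≥ 4k neighbours outside the cover.
    length-witnesses-heavy : ∀ u → 20 * k ≤ degree G u → length (witnesses u) ≡ 4 * k
    length-witnesses-heavy u heavy = trans (length-take (4 * k) candidates) (m≤n⇒m⊓n≡m 4k≤)
      where
      outside : Fin n → Bool
      outside w = adj G u w ∧ not (inCover w)
      candidates : List (Fin n)
      candidates = filterᵇ outside (allFin n)
      open +-*-Solver
      4k≤ : 4 * k ≤ length candidates
      4k≤ = subst (4 * k ≤_) (sym (length-filterᵇ outside (allFin n)))
        (+-cancelʳ-≤ k (4 * k) _ (begin
          4 * k + k                                    ≤⟨ ≤-trans (≤-reflexive (solve 1 (λ k → con 4 :* k :+ k := con 5 :* k) refl k)) (*-monoˡ-≤ k (m≤m+n 5 15)) ⟩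
          20 * k                                       ≤⟨ heavy ⟩
          degree G u                                   ≡⟨ trans (sym (length-nbrs u)) (length-filterᵇ (adj G u) (allFin n)) ⟩
          count (adj G u) (allFin n)                   ≤⟨ count-split (adj G u) inCover (allFin n) ⟩
          count outside (allFin n) + count inCover (allFin n) ≤⟨ +-monoʳ-≤ (count outside (allFin n)) count-cover ⟩
          count outside (allFin n) + k                 ∎))
        where open ≤-Reasoning

    module Sample {b} (h : Hash n b) (a : Answers n b) (valid : ValidAnswers G h a) where

      colour : Fin n → Fin b
      colour = lookup h

      QueryAnswer : Fin n → Fin n → Set
      QueryAnswer u v = ∃ λ x → ∃ λ y → a (colour u) (colour v) ≡ just (x , y)
                                        × colour x ≡ colour u × colour y ≡ colour v × Edge G x y

      query-answer : ∀ u v → Edge G u v → colour u ≢ colour v → QueryAnswer u v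
      query-answer u v uv different with a (colour u) (colour v) in answer
      ... | nothing      = ⊥-elim (proj₁ (valid _ _ different) answer u v refl refl uv)
      ... | just (x , y) = x , y , refl , proj₂ (valid _ _ different) x y answer

      -- If uv is an edge and its edge test passes, the query returns uv:
      -- a returned edge xy has an endpoint in the cover, which by the absence
      -- of collisions is u (resp. v), and then the other endpoint is a
      -- neighbour of u (resp. v) coloured like v (resp. u), hence v (resp. u).
      edge-sound : ∀ u v → Edge G u v → T (passes (edgeTest u v) h) → Returned a u v
      edge-sound u v uv passing = colour u , colour v , different , returns-uv (query-answer u v uv different)
        where
        free : ∀ {x y} → (x , y) ∈ pairs (edgeTest u v) → colour x ≡ colour y → x ≡ y
        free = collision-free {h = h} (n<1⇒n≡0 (<ᵇ⇒< _ _ passing))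
        different : colour u ≢ colour v
        different same = adj-irrefl G u (subst (Edge G u) (sym (free (here refl) same)) uv)
        from-u : ∀ {z} → z ∈ cover ++ nbrs v → colour u ≡ colour z → u ≡ z
        from-u z∈ = free (there (∈-++⁺ˡ (∈-map⁺ (u ,_) z∈)))
        from-v : ∀ {z} → z ∈ cover ++ nbrs u → colour v ≡ colour z → v ≡ z
        from-v z∈ = free (there (∈-++⁺ʳ (u ⊗ (cover ++ nbrs v)) (∈-map⁺ (v ,_) z∈)))
        endpoints : ∀ x y → colour x ≡ colour u → colour y ≡ colour v → Edge G x y → u ≡ x × v ≡ y
        endpoints x y xu yv xy with isCover x y xy
        ... | inj₁ x∈C = u≡x , from-v (∈-++⁺ʳ cover (nbrs-∈ (subst (λ z → Edge G z y) (sym u≡x) xy))) (sym yv)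
          where u≡x = from-u (∈-++⁺ˡ (cover-∈ x∈C)) (sym xu)
        ... | inj₂ y∈C = from-u (∈-++⁺ʳ cover (nbrs-∈ (subst (λ z → Edge G z x) (sym v≡y) (trans (adj-sym G y x) xy)))) (sym xu) , v≡y
          where v≡y = from-v (∈-++⁺ˡ (cover-∈ y∈C)) (sym yv)
        returns-uv : QueryAnswer u v → a (colour u) (colour v) ≡ just (u , v)
        returns-uv (x , y , answer , xu , yv , xy) with endpoints x y xu yv xy
        ... | refl , refl = answer

      module Vertex (u : Fin n) (u∈C : T (inCover u)) where

        W : List (Fin n)
        W = witnesses u

        collisions-of : Fin n → ℕ
        collisions-of w = collisions h (w ⊗ (W ++ cover))

        collisions-vertexTest : collisions h (pairs (vertexTest u)) ≡ sumBy collisions-of W + 2 * k * collisions h (u ⊗ cover)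
        collisions-vertexTest =
          trans (sumBy-++ _ (concatMap (λ w → w ⊗ (W ++ cover)) W) (concat (replicate (2 * k) (u ⊗ cover))))
                (cong₂ _+_ (sumBy-concatMap _ (λ w → w ⊗ (W ++ cover)) W) (sumBy-replicate _ (2 * k) (u ⊗ cover)))

        partner : Fin n → Fin n
        partner w = maybe′ proj₂ w (a (colour u) (colour w))

        -- If u collides with no cover vertex and the witness w with no other
        -- witness and no cover vertex, the query (V_h(u) , V_h(w)) returns an
        -- edge at u whose other endpoint is coloured like w: the cover
        -- endpoint of the returned edge is coloured like u, hence is u.
        clean-witness : collisions h (u ⊗ cover) ≡ 0 → ∀ {w} → w ∈ W → collisions-of w ≡ 0 →
                        Returned a u (partner w) × colour (partner w) ≡ colour w
        clean-witness u-clean {w} w∈W w-clean = from-answer (query-answer u w (proj₁ (witness-facts w∈W)) different)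
          where
          not-in-cover : ∀ {z} → T (inCover z) → colour w ≢ colour z
          not-in-cover {z} z∈C same = proj₂ (witness-facts w∈W)
            (subst (T ∘ inCover) (sym (collision-free {h = h} w-clean (∈-map⁺ (w ,_) (∈-++⁺ʳ W (cover-∈ z∈C))) same)) z∈C)
          different : colour u ≢ colour w
          different same = not-in-cover u∈C (sym same)
          source : ∀ x y → colour x ≡ colour u → colour y ≡ colour w → Edge G x y → u ≡ x
          source x y xu yw xy with isCover x y xy
          ... | inj₁ x∈C = collision-free {h = h} u-clean (∈-map⁺ (u ,_) (cover-∈ x∈C)) (sym xu)
          ... | inj₂ y∈C = ⊥-elim (not-in-cover y∈C (sym yw))
          from-answer : QueryAnswer u w → Returned a u (partner w) × colour (partner w) ≡ colour w
          from-answer (x , y , answer , xu , yw , xy) =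
            (colour u , colour w , different , trans answer (cong₂ (λ p q → just (p , q)) (sym (source x y xu yw xy)) (sym partner≡y))) ,
            trans (cong colour partner≡y) yw
            where
            partner≡y : partner w ≡ y
            partner≡y = cong (maybe′ proj₂ w) answer

        -- If the vertex test passes, u has no collision with the cover and
        -- fewer than 2k collisions involve witnesses, so at least 2k of the
        -- 4k witnesses are clean; their partners are distinct because clean
        -- witnesses have pairwise distinct colours.
        vertex-sound : length W ≡ 4 * k → T (passes (vertexTest u) h) → ReturnedNeighbours a u (2 * k)
        vertex-sound |W| passing = map partner clean , unique , AllP.map⁺ (All.tabulate (proj₁ ∘ partner-facts)) , many
          where
          split : collisions h (u ⊗ cover) ≡ 0 × sumBy collisions-of W < 2 * k
          split = weighted-small (sumBy collisions-of W) (collisions h (u ⊗ cover)) (2 * k)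
                    (subst (_< 2 * k) collisions-vertexTest (<ᵇ⇒< _ _ passing))
          isClean : Fin n → Bool
          isClean w = collisions-of w ≡ᵇ 0
          clean : List (Fin n)
          clean = filterᵇ isClean W
          clean-facts : ∀ {w} → w ∈ clean → w ∈ W × collisions-of w ≡ 0
          clean-facts w∈ with ∈-filter⁻ (T? ∘ isClean) w∈
          ... | w∈W , w-clean = w∈W , ≡ᵇ⇒≡ _ _ w-clean
          partner-facts : ∀ {w} → w ∈ clean → Returned a u (partner w) × colour (partner w) ≡ colour w
          partner-facts w∈ = clean-witness (proj₁ split) (proj₁ (clean-facts w∈)) (proj₂ (clean-facts w∈))
          distinct : ∀ {w w'} → w ∈ clean → w' ∈ clean → w ≢ w' → partner w ≢ partner w'
          distinct {w} w∈ w'∈ w≢w' same = w≢w' (collision-free {h = h} (proj₂ (clean-facts w∈))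
            (∈-map⁺ (w ,_) (∈-++⁺ˡ (proj₁ (clean-facts w'∈))))
            (trans (sym (proj₂ (partner-facts w∈))) (trans (cong colour same) (proj₂ (partner-facts w'∈)))))
          unique : Unique (map partner clean)
          unique = unique-map partner (UniqueP.filter⁺ (T? ∘ isClean) (witnesses-unique u)) distinct
          open +-*-Solver
          many : 2 * k ≤ length (map partner clean)
          many = subst (2 * k ≤_) (sym (length-map partner clean)) (+-cancelʳ-≤ (2 * k) (2 * k) (length clean) (begin
            2 * k + 2 * k                         ≡⟨ solve 1 (λ k → con 2 :* k :+ con 2 :* k := con 4 :* k) refl k ⟩
            4 * k                                 ≡⟨ sym |W| ⟩
            length W                              ≤⟨ few-nonzero collisions-of W ⟩
            count isClean W + sumBy collisions-of W ≤⟨ +-mono-≤ (≤-reflexive (sym (length-filterᵇ isClean W))) (<⇒≤ (proj₂ split)) ⟩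
            length clean + 2 * k                  ∎))
            where open ≤-Reasoning

    -- Outside the bad event the outcome is good: every light edge has an
    -- endpoint u in the cover, so its edge test passes on some sample; every
    -- heavy vertex lies in the cover, so its vertex test passes on some sample.
    good-outcome : ∀ (ω : Outcome n k) → ¬ T (someTestFailsAlways tests ω) → Good G k ω
    good-outcome ω fine ans valid = light-edges , heavy-vertices
      where
      Passes : Test n → Set
      Passes τ = ∃ λ s → T (passes τ (lookup ω s))
      passes-on : ∀ {τ} → τ ∈ tests → Passes τ
      passes-on = passes-somewhere ω fine
      edge-in-Ĝ : ∀ {u v} → Edge G u v → Passes (edgeTest u v) → HatEdge ans u v
      edge-in-Ĝ {u} {v} uv (s , passing) = returned⇒edge s (Sample.edge-sound (lookup ω s) (ans s) (valid s) u v uv passing)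
      edgeTest∈tests : ∀ {u v} → T (inCover u) → Edge G u v → T (light u) → T (light v) → edgeTest u v ∈ tests
      edgeTest∈tests {u} u∈C uv light-u light-v = ∈-++⁺ˡ (∈-concatMap⁺ (λ c → map (edgeTest c) (filterᵇ light (nbrs c)))
          (∈-map⁺ (edgeTest u) (∈-filter⁺ (T? ∘ light) (nbrs-∈ uv) light-v))
          (∈-filter⁺ (T? ∘ light) (cover-∈ u∈C) light-u))
      swap : ∀ {u v} → HatEdge ans v u → HatEdge ans u v
      swap (s , i , j , i≢j , inj₁ answer) = s , i , j , i≢j , inj₂ answer
      swap (s , i , j , i≢j , inj₂ answer) = s , i , j , i≢j , inj₁ answer
      light-edges : ∀ u v → Edge G u v → degree G u < 20 * k → degree G v < 20 * k → HatEdge ans u v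
      light-edges u v uv du dv with isCover u v uv
      ... | inj₁ u∈C = edge-in-Ĝ uv (passes-on (edgeTest∈tests u∈C uv (<⇒<ᵇ du) (<⇒<ᵇ dv)))
      ... | inj₂ v∈C = swap (edge-in-Ĝ vu (passes-on (edgeTest∈tests v∈C vu (<⇒<ᵇ dv) (<⇒<ᵇ du))))
        where vu = trans (adj-sym G v u) uv
      vertexTest∈tests : ∀ {u} → T (inCover u) → T (not (light u)) → vertexTest u ∈ tests
      vertexTest∈tests {u} u∈C heavy-u =
        ∈-++⁺ʳ (concatMap (λ c → map (edgeTest c) (filterᵇ light (nbrs c))) (filterᵇ light cover))
               (∈-map⁺ vertexTest (∈-filter⁺ (T? ∘ (not ∘ light)) (cover-∈ u∈C) heavy-u))
      degree-in-Ĝ : ∀ {u} → T (inCover u) → length (witnesses u) ≡ 4 * k → Passes (vertexTest u) → HatDegree≥ ans u (2 * k)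
      degree-in-Ĝ {u} u∈C |W| (s , passing) =
        returned⇒degree s (Sample.Vertex.vertex-sound (lookup ω s) (ans s) (valid s) u u∈C |W| passing)
      heavy-vertices : ∀ u → 20 * k ≤ degree G u → HatDegree≥ ans u (2 * k)
      heavy-vertices u heavy =
        degree-in-Ĝ u∈C (length-witnesses-heavy u heavy) (passes-on (vertexTest∈tests u∈C not-light))
        where
        u∈C : T (inCover u)
        u∈C = heavy-in-cover u heavy
        not-light : T (not (light u))
        not-light = ¬T⇒T-not (λ light-u → <⇒≱ (<ᵇ⇒< _ _ light-u) heavy)

length-outcomes : ∀ n k → length (samples (numColours k) n (numSamples k)) ≡ numOutcomes n k
length-outcomes n k = trans (length-vectors (hashes (numColours k) n) (numSamples k))
                            (cong (_^ numSamples k) (length-hashes (numColours k) n))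

bad-outcomes : ∀ {n} (G : Graph n) k (C : Subset n) → 2 ≤ k → ∣ C ∣ ≤ k →
  count (someTestFailsAlways (Tests.tests G k C)) (samples (numColours k) n (numSamples k)) * k ≤ numOutcomes n k
bad-outcomes {n} G k C 2≤k |C|≤k = *-cancelˡ-≤ (2 ^ t) {{m^n≢0 2 t}} (begin
  2 ^ t * (#bad * k)      ≡⟨ solve 3 (λ P B k → P :* (B :* k) := B :* P :* k) refl (2 ^ t) #bad k ⟩
  #bad * 2 ^ t * k        ≤⟨ *-monoˡ-≤ k (bad-event-probability colours n t τs 1≤colours (Sizes.tests-admissible |C|≤k 1≤k)) ⟩
  length τs * N * k    ≡⟨ solve 3 (λ e N k → e :* N :* k := e :* k :* N) refl (length τs) N k ⟩
  length τs * k * N    ≤⟨ *-monoˡ-≤ N (enough-samples k (length τs) 2≤k (Sizes.length-tests |C|≤k 1≤k)) ⟩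
  2 ^ t * N            ∎)
  where
  open Tests G k C
  open ≤-Reasoning
  open +-*-Solver
  colours : ℕ
  colours = numColours k
  t : ℕ
  t = numSamples k
  N : ℕ
  N = numOutcomes n k
  τs : List (Test n)
  τs = tests
  #bad : ℕ
  #bad = count (someTestFailsAlways τs) (samples colours n t)
  1≤k : 1 ≤ k
  1≤k = ≤-trans (s≤s z≤n) 2≤k
  1≤colours : 1 ≤ colours
  1≤colours = ≤-trans 1≤k (m≤n*m k 1000)

good-with-probability : ∀ n (G : Graph n) k → 2 ≤ k → HasVertexCoverOfSize≤ G k → ProbGoodAtLeast G k 1 1
good-with-probability n G k 2≤k (C , |C|≤k , isCover) = goodOutcomes , unique , all-good , bound
  where
  bad : Outcome n k → Bool
  bad = someTestFailsAlways (Tests.tests G k C)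
  Ω : List (Outcome n k)
  Ω = samples (numColours k) n (numSamples k)
  N : ℕ
  N = numOutcomes n k
  goodOutcomes : List (Outcome n k)
  goodOutcomes = filterᵇ (not ∘ bad) Ω
  unique : Unique goodOutcomes
  unique = UniqueP.filter⁺ (T? ∘ (not ∘ bad)) (vectors-unique _ (vectors-unique n (UniqueP.allFin⁺ _)))
  covers : ∀ u v → Edge G u v → T (lookup C u) ⊎ T (lookup C v)
  covers u v uv = Sum.map (Equivalence.from T-≡ ∘ []=⇒lookup) (Equivalence.from T-≡ ∘ []=⇒lookup) (isCover u v uv)
  all-good : All (Good G k) goodOutcomes
  all-good = All.map (λ {ω} → Tests.Soundness.good-outcome G k C |C|≤k (≤-trans (s≤s z≤n) 2≤k) covers ω ∘ T-not⇒¬T)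
                     (AllP.all-filter (T? ∘ (not ∘ bad)) Ω)
  bound : (N ∸ length goodOutcomes) ^ 1 * k ^ 1 ≤ N ^ 1
  bound = begin
    (N ∸ length goodOutcomes) ^ 1 * k ^ 1 ≡⟨ cong₂ _*_ (^-identityʳ (N ∸ length goodOutcomes)) (^-identityʳ k) ⟩
    (N ∸ length goodOutcomes) * k         ≡⟨ cong (λ M → (M ∸ length goodOutcomes) * k) (sym (length-outcomes n k)) ⟩
    (length Ω ∸ length goodOutcomes) * k  ≡⟨ cong (_* k) (length-filterᵇ-not bad Ω) ⟩
    count bad Ω * k                       ≤⟨ bad-outcomes G k C 2≤k |C|≤k ⟩
    N                                     ≡⟨ sym (^-identityʳ N) ⟩
    N ^ 1                                 ∎
    where open ≤-Reasoning

lemma3 : Σ ℕ λ p → Σ ℕ λ q → 1 ≤ p × 1 ≤ q ×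
           (∀ (n : ℕ) (G : Graph n) (k : ℕ) → 2 ≤ k →
             HasVertexCoverOfSize≤ G k → ProbGoodAtLeast G k p q)
lemma3 = 1 , 1 , ≤-refl , ≤-refl , good-with-probability
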